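{- Let $M=(V,d)$ be a finite metric space with all distances in $\{0,1,2\}$, with $|V|\geq 3$ and with no pairs of twins. Then $\ell^*(M)+\textsc{up}(M)\geq |V|$.
   Context: For distinct $x,y\in V$, $\overline{xy}^M=\{z\in V: d(x,y)=d(x,z)+d(z,y)\ \text{or}\ d(x,y)=|d(x,z)-d(z,y)|\}$. A line is universal if it equals $V$; then $\{x,y\}$ is a universal pair. $\ell^*(M)$ is the number of distinct non-universal lines and $\textsc{up}(M)$ the number of universal pairs. A pair of twins is a pair $(a,a')$ of distinct points with $d(a,a')\neq 1$ and $d(a,u)=d(a',u)$ for all $u\notin\{a,a'\}$. -}

module Defs where

open import Data.Nat using (ℕ; _+_; _≤_; _<?_; ∣_-_∣)
import Data.Nat as ℕ
open import Data.Fin using (Fin; toℕ)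
open import Data.Bool using (Bool)
import Data.Bool as 𝔹
open import Data.Vec using (Vec; tabulate)
open import Data.Vec.Properties using (≡-dec)
open import Data.List using (List; length; filter; map; deduplicate; cartesianProduct; allFin)
open import Data.Product using (_×_; _,_; proj₁; proj₂; Σ; ∃)
open import Data.Sum using (_⊎_)
open import Data.Fin.Subset using (Subset; ⊤)
open import Relation.Nullary using (¬_; Dec)
open import Relation.Nullary.Decidable using (does; _⊎-dec_; ¬?)
open import Relation.Binary.PropositionalEquality using (_≡_; _≢_)

record IsMetric (n : ℕ) (d : Fin n → Fin n → ℕ) : Set where
  field
    zero-self : ∀ x → d x x ≡ 0
    pos       : ∀ x y → x ≢ y → d x y ≢ 0
    sym       : ∀ x y → d x y ≡ d y x
    triangle  : ∀ x y z → d x z ≤ d x y + d y z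

Dist012 : (n : ℕ) → (Fin n → Fin n → ℕ) → Set
Dist012 n d = ∀ x y → d x y ≤ 2

OnLine : (n : ℕ) → (Fin n → Fin n → ℕ) → Fin n → Fin n → Fin n → Set
OnLine n d x y z = (d x y ≡ d x z + d z y) ⊎ (d x y ≡ ∣ d x z - d z y ∣)

onLine? : (n : ℕ) (d : Fin n → Fin n → ℕ) (x y z : Fin n) → Dec (OnLine n d x y z)
onLine? n d x y z = (d x y ℕ.≟ (d x z + d z y)) ⊎-dec (d x y ℕ.≟ ∣ d x z - d z y ∣)

line : (n : ℕ) → (Fin n → Fin n → ℕ) → Fin n → Fin n → Subset n
line n d x y = tabulate (λ z → does (onLine? n d x y z))

subset-≟ : ∀ {n} (A B : Subset n) → Dec (A ≡ B)
subset-≟ = ≡-dec 𝔹._≟_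

pairs : (n : ℕ) → List (Fin n × Fin n)
pairs n = filter (λ p → toℕ (proj₁ p) <? toℕ (proj₂ p)) (cartesianProduct (allFin n) (allFin n))

UP : (n : ℕ) → (Fin n → Fin n → ℕ) → ℕ
UP n d = length (filter (λ p → subset-≟ (line n d (proj₁ p) (proj₂ p)) ⊤) (pairs n))

ℓ* : (n : ℕ) → (Fin n → Fin n → ℕ) → ℕ
ℓ* n d = length (deduplicate subset-≟
           (filter (λ L → ¬? (subset-≟ L ⊤))
             (map (λ p → line n d (proj₁ p) (proj₂ p)) (pairs n))))

Twins : (n : ℕ) → (Fin n → Fin n → ℕ) → Fin n → Fin n → Set
Twins n d a a' = (a ≢ a') × (d a a' ≢ 1) × (∀ u → u ≢ a → u ≢ a' → d a u ≡ d a' u)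

NoTwins : (n : ℕ) → (Fin n → Fin n → ℕ) → Set
NoTwins n d = ∀ a a' → ¬ Twins n d a a'

module Submission where

-- Every point v is labelled by a pair of distinct points such that two
-- distinct points get the same line only if that line is universal and their
-- pairs differ.  A general counting principle ('Counting') then gives the bound:
-- non-universal labels inject into the distinct non-universal lines, universal
-- labels into the universal pairs.
--
-- The labelling ('Labelling') is relative to a base point x.  A near point v
-- (d x v = 1) gets the line x v; a far point v (d x v = 2) gets x v unless a near
-- y spans the same line with x (a partner of v), in which case v gets the line
-- y v if it is universal and otherwise a line y b with b far and d b v = 2; x
-- itself gets a line avoiding x.  Separation is a case analysis using the shape
-- of segments of length 1 and 2 ('TwoDistance'): equal lines through x either
-- produce twins or are excluded outright, and lines avoiding x are told apart
-- through the partners.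

open import Defs
open import Data.Nat using (ℕ; _≤_; _+_)
open import Data.Fin using (Fin)

open import Data.Nat using (suc; s≤s; ∣_-_∣; _<?_) renaming (_≟_ to _≟ℕ_)
open import Data.Nat.Properties using (+-comm; +-identityʳ; ∣-∣-comm; ≤∧≢⇒<; ≮⇒≥)
import Data.Fin as F
open import Data.Fin using (toℕ; join; splitAt; _≟_)
open import Data.Fin.Properties using (toℕ-injective; splitAt-join; injective⇒≤; ¬∀⟶∃¬; any?)
open import Data.Fin.Subset using (Subset; ⊤)
open import Data.Bool using (true)
open import Data.Vec using (lookup)
open import Data.Vec.Properties using (lookup∘tabulate; lookup-replicate; tabulate-cong; tabulate∘lookup)
open import Data.List using (List; length; filter; map; deduplicate)
open import Data.List.Membership.Propositional using (_∈_)
open import Data.List.Membership.Propositional.Properties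
  using (∈-filter⁺; ∈-map⁺; ∈-deduplicate⁺; ∈-cartesianProduct⁺; ∈-allFin)
import Data.List.Membership.Setoid.Properties as SetoidMembership
open import Data.List.Relation.Unary.Any using (index)
open import Data.Product using (Σ; _×_; _,_; proj₁; proj₂)
open import Data.Sum using (_⊎_; inj₁; inj₂)
open import Data.Sum.Properties using (inj₁-injective; inj₂-injective)
open import Data.Empty using (⊥; ⊥-elim)
open import Function.Definitions using (Injective)
open import Relation.Nullary using (¬_; Dec; yes; no)
open import Relation.Nullary.Decidable using (¬?; _×-dec_; dec-true; does-⇔; toWitness; isYes≗does; decidable-stable)
open import Function.Bundles using (mk⇔; Equivalence)
open import Data.Bool.Properties using (T-≡)
open import Relation.Binary.PropositionalEquality
  using (_≡_; _≢_; ≢-sym; refl; sym; trans; cong; cong₂; subst; setoid)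

module Lines {n : ℕ} (d : Fin n → Fin n → ℕ) where

  On : Fin n → Fin n → Fin n → Set
  On = OnLine n d

  L : Fin n → Fin n → Subset n
  L = line n d

  lineOf : Fin n × Fin n → Subset n
  lineOf p = L (proj₁ p) (proj₂ p)

  on⇒∈ : ∀ {u v z} → On u v z → lookup (L u v) z ≡ true
  on⇒∈ {u} {v} {z} o = trans (lookup∘tabulate _ z) (dec-true (onLine? n d u v z) o)

  ∈⇒on : ∀ {u v z} → lookup (L u v) z ≡ true → On u v z
  ∈⇒on {u} {v} {z} e =
    toWitness {a? = p} (Equivalence.from T-≡ (trans (isYes≗does p) (trans (sym (lookup∘tabulate _ z)) e)))
    where p : Dec (On u v z)
          p = onLine? n d u v z

  transport : ∀ {u v u' v' z} → L u v ≡ L u' v' → On u v z → On u' v' z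
  transport {z = z} e o = ∈⇒on (trans (cong (λ S → lookup S z) (sym e)) (on⇒∈ o))

  universal⇒on : ∀ {u v} z → L u v ≡ ⊤ → On u v z
  universal⇒on z e = ∈⇒on (trans (cong (λ S → lookup S z) e) (lookup-replicate z true))

  on⇒universal : ∀ {u v} → (∀ z → On u v z) → L u v ≡ ⊤
  on⇒universal {u} {v} h =
    trans (tabulate-cong (λ z → trans (dec-true (onLine? n d u v z) (h z)) (sym (lookup-replicate z true))))
          (tabulate∘lookup ⊤)

module SymmetricLines {n : ℕ} (d : Fin n → Fin n → ℕ) (d-sym : ∀ u v → d u v ≡ d v u) where
  open Lines d

  on-sym : ∀ {u v z} → On u v z → On v u z
  on-sym {u} {v} {z} (inj₁ e) =
    inj₁ (trans (d-sym v u) (trans e (trans (cong₂ _+_ (d-sym u z) (d-sym z v)) (+-comm (d z u) (d v z)))))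
  on-sym {u} {v} {z} (inj₂ e) =
    inj₂ (trans (d-sym v u) (trans e (trans (cong₂ ∣_-_∣ (d-sym u z) (d-sym z v)) (∣-∣-comm (d z u) (d v z)))))

  line-sym : ∀ u v → L u v ≡ L v u
  line-sym u v = tabulate-cong (λ z → does-⇔ (mk⇔ on-sym on-sym) (onLine? n d u v z) (onLine? n d v u z))

SamePair : ∀ {n} → Fin n × Fin n → Fin n × Fin n → Set
SamePair (a , b) (a' , b') = (a ≡ a' × b ≡ b') ⊎ (a ≡ b' × b ≡ a')

index-injective : ∀ {A : Set} {x y : A} {xs} (x∈ : x ∈ xs) (y∈ : y ∈ xs) → index x∈ ≡ index y∈ → x ≡ y
index-injective = SetoidMembership.index-injective (setoid _)

join-injective : ∀ m k {x y : Fin m ⊎ Fin k} → join m k x ≡ join m k y → x ≡ y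
join-injective m k {x} {y} e = trans (sym (splitAt-join m k x)) (trans (cong (splitAt m) e) (splitAt-join m k y))

module Counting {n : ℕ} (d : Fin n → Fin n → ℕ) (d-sym : ∀ u v → d u v ≡ d v u) where
  open Lines d
  open SymmetricLines d d-sym

  UniversalPairs : List (Fin n × Fin n)
  UniversalPairs = filter (λ p → subset-≟ (lineOf p) ⊤) (pairs n)

  NonUniversalLines : List (Subset n)
  NonUniversalLines = deduplicate subset-≟ (filter (λ S → ¬? (subset-≟ S ⊤)) (map lineOf (pairs n)))

  -- 'pairs n' lists each unordered pair once, smaller point first
  order : Fin n × Fin n → Fin n × Fin n
  order (a , b) with toℕ a <? toℕ b
  ... | yes _ = a , b
  ... | no _  = b , a

  order-∈pairs : ∀ {a b} → a ≢ b → order (a , b) ∈ pairs n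
  order-∈pairs {a} {b} a≢b with toℕ a <? toℕ b
  ... | yes a<b = ∈-filter⁺ _ (∈-cartesianProduct⁺ (∈-allFin a) (∈-allFin b)) a<b
  ... | no a≮b  = ∈-filter⁺ _ (∈-cartesianProduct⁺ (∈-allFin b) (∈-allFin a))
                    (≤∧≢⇒< (≮⇒≥ a≮b) (λ e → a≢b (toℕ-injective (sym e))))

  order-line : ∀ p → lineOf (order p) ≡ lineOf p
  order-line (a , b) with toℕ a <? toℕ b
  ... | yes _ = refl
  ... | no _  = line-sym b a

  order-same : ∀ p q → order p ≡ order q → SamePair p q
  order-same (a , b) (a' , b') e with toℕ a <? toℕ b | toℕ a' <? toℕ b'
  ... | yes _ | yes _ = inj₁ (cong proj₁ e , cong proj₂ e)
  ... | yes _ | no _  = inj₂ (cong proj₁ e , cong proj₂ e)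
  ... | no _  | yes _ = inj₂ (cong proj₂ e , cong proj₁ e)
  ... | no _  | no _  = inj₁ (cong proj₂ e , cong proj₁ e)

  module _ {m : ℕ} (f : Fin m → Fin n × Fin n) (distinct : ∀ i → proj₁ (f i) ≢ proj₂ (f i))
           (separated : ∀ i j → i ≢ j → lineOf (f i) ≡ lineOf (f j) →
                          lineOf (f i) ≡ ⊤ × ¬ SamePair (f i) (f j)) where

    key : Fin m → Fin n × Fin n
    key i = order (f i)

    key-line : ∀ i → lineOf (key i) ≡ lineOf (f i)
    key-line i = order-line (f i)

    -- a universal label is recorded by its pair, a non-universal one by its line
    code : ∀ i → Dec (lineOf (f i) ≡ ⊤) → Fin (length NonUniversalLines) ⊎ Fin (length UniversalPairs)
    code i (yes univ) =
      inj₂ (index (∈-filter⁺ (λ p → subset-≟ (lineOf p) ⊤) (order-∈pairs (distinct i))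
                                (trans (key-line i) univ)))
    code i (no ¬univ) =
      inj₁ (index (∈-deduplicate⁺ subset-≟ (∈-filter⁺ (λ S → ¬? (subset-≟ S ⊤))
              (∈-map⁺ lineOf (order-∈pairs (distinct i))) (λ univ → ¬univ (trans (sym (key-line i)) univ)))))

    same-line : ∀ {i j} → lineOf (key i) ≡ lineOf (key j) → lineOf (f i) ≡ lineOf (f j)
    same-line {i} {j} e = trans (sym (key-line i)) (trans e (key-line j))

    code-separates : ∀ i j (di : Dec (lineOf (f i) ≡ ⊤)) (dj : Dec (lineOf (f j) ≡ ⊤)) →
                     i ≢ j → code i di ≢ code j dj
    code-separates i j (yes _) (yes _) i≢j e =
      proj₂ (separated i j i≢j (same-line (cong lineOf keys))) (order-same (f i) (f j) keys)
      where keys : key i ≡ key j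
            keys = index-injective _ _ (inj₂-injective e)
    code-separates i j (no ¬univ) (no _) i≢j e =
      ¬univ (proj₁ (separated i j i≢j (same-line (index-injective _ _ (inj₁-injective e)))))
    code-separates i j (yes _) (no _) i≢j ()
    code-separates i j (no _) (yes _) i≢j ()

    code′ : Fin m → Fin (length NonUniversalLines) ⊎ Fin (length UniversalPairs)
    code′ i = code i (subset-≟ (lineOf (f i)) ⊤)

    encode : Fin m → Fin (length NonUniversalLines + length UniversalPairs)
    encode i = join (length NonUniversalLines) (length UniversalPairs) (code′ i)

    encode-injective : Injective _≡_ _≡_ encode
    encode-injective {i} {j} e with i ≟ j
    ... | yes i≡j = i≡j
    ... | no i≢j  = ⊥-elim (code-separates i j (subset-≟ (lineOf (f i)) ⊤) (subset-≟ (lineOf (f j)) ⊤) i≢j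
                             (join-injective (length NonUniversalLines) (length UniversalPairs) e))

    count : m ≤ ℓ* n d + UP n d
    count = injective⇒≤ encode-injective

-- 'Degenerate a b c': a triangle with sides a, b, c is flat, a being the sum or
-- the difference of b and c.  'OnLine n d u v z' unfolds to
-- 'Degenerate (d u v) (d u z) (d z v)'.
Degenerate : ℕ → ℕ → ℕ → Set
Degenerate a b c = a ≡ b + c ⊎ a ≡ ∣ b - c ∣

OneOrTwo : ℕ → Set
OneOrTwo b = b ≡ 1 ⊎ b ≡ 2

one≢two : ∀ {k} → k ≡ 1 → k ≡ 2 → ⊥
one≢two refl ()

degenerate-1 : ∀ {a b c} → a ≡ 1 → OneOrTwo b → OneOrTwo c → Degenerate a b c →
               (b ≡ 1 × c ≡ 2) ⊎ (b ≡ 2 × c ≡ 1)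
degenerate-1 refl (inj₁ refl) (inj₁ refl) (inj₁ ())
degenerate-1 refl (inj₁ refl) (inj₁ refl) (inj₂ ())
degenerate-1 refl (inj₁ refl) (inj₂ refl) _ = inj₁ (refl , refl)
degenerate-1 refl (inj₂ refl) (inj₁ refl) _ = inj₂ (refl , refl)
degenerate-1 refl (inj₂ refl) (inj₂ refl) (inj₁ ())
degenerate-1 refl (inj₂ refl) (inj₂ refl) (inj₂ ())

degenerate-1⁻¹ : ∀ {a b c} → a ≡ 1 → (b ≡ 1 × c ≡ 2) ⊎ (b ≡ 2 × c ≡ 1) → Degenerate a b c
degenerate-1⁻¹ refl (inj₁ (refl , refl)) = inj₂ refl
degenerate-1⁻¹ refl (inj₂ (refl , refl)) = inj₂ refl

degenerate-2 : ∀ {a b c} → a ≡ 2 → OneOrTwo b → OneOrTwo c → Degenerate a b c → b ≡ 1 × c ≡ 1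
degenerate-2 refl (inj₁ refl) (inj₁ refl) _ = refl , refl
degenerate-2 refl (inj₁ refl) (inj₂ refl) (inj₁ ())
degenerate-2 refl (inj₁ refl) (inj₂ refl) (inj₂ ())
degenerate-2 refl (inj₂ refl) (inj₁ refl) (inj₁ ())
degenerate-2 refl (inj₂ refl) (inj₁ refl) (inj₂ ())
degenerate-2 refl (inj₂ refl) (inj₂ refl) (inj₁ ())
degenerate-2 refl (inj₂ refl) (inj₂ refl) (inj₂ ())

degenerate-2⁻¹ : ∀ {a b c} → a ≡ 2 → b ≡ 1 → c ≡ 1 → Degenerate a b c
degenerate-2⁻¹ refl refl refl = inj₁ refl

flat-1-1-1 : ¬ Degenerate 1 1 1
flat-1-1-1 = λ { (inj₁ ()) ; (inj₂ ()) }

flat-1-2-2 : ¬ Degenerate 1 2 2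
flat-1-2-2 = λ { (inj₁ ()) ; (inj₂ ()) }

degenerate-1-determines : ∀ {a a' b c c'} → a ≡ 1 → a' ≡ 1 → OneOrTwo b → OneOrTwo c → OneOrTwo c' →
                          (Degenerate a b c → Degenerate a' b c') → (Degenerate a' b c' → Degenerate a b c) →
                          c ≡ c'
degenerate-1-determines refl refl _ (inj₁ refl) (inj₁ refl) _ _ = refl
degenerate-1-determines refl refl _ (inj₂ refl) (inj₂ refl) _ _ = refl
degenerate-1-determines refl refl (inj₁ refl) (inj₁ refl) (inj₂ refl) _ g = ⊥-elim (flat-1-1-1 (g (inj₂ refl)))
degenerate-1-determines refl refl (inj₂ refl) (inj₁ refl) (inj₂ refl) f _ = ⊥-elim (flat-1-2-2 (f (inj₂ refl)))
degenerate-1-determines refl refl (inj₁ refl) (inj₂ refl) (inj₁ refl) f _ = ⊥-elim (flat-1-1-1 (f (inj₂ refl)))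
degenerate-1-determines refl refl (inj₂ refl) (inj₂ refl) (inj₁ refl) _ g = ⊥-elim (flat-1-2-2 (g (inj₂ refl)))

two-others : ∀ {n} → 3 ≤ n → (x : Fin n) → Σ (Fin n) λ p → Σ (Fin n) λ q → p ≢ x × q ≢ x × p ≢ q
two-others (s≤s (s≤s (s≤s _))) F.zero               = F.suc F.zero , F.suc (F.suc F.zero) , (λ ()) , (λ ()) , (λ ())
two-others (s≤s (s≤s (s≤s _))) (F.suc F.zero)       = F.zero , F.suc (F.suc F.zero) , (λ ()) , (λ ()) , (λ ())
two-others (s≤s (s≤s (s≤s _))) (F.suc (F.suc _))    = F.zero , F.suc F.zero , (λ ()) , (λ ()) , (λ ())

module TwoDistance {n : ℕ} (d : Fin n → Fin n → ℕ) (M : IsMetric n d) (D : Dist012 n d) where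
  open IsMetric M renaming (sym to d-sym)
  open Lines d

  one-or-two : ∀ {u v} → u ≢ v → OneOrTwo (d u v)
  one-or-two {u} {v} u≢v with d u v | pos u v u≢v | D u v
  ... | 0 | d≢0 | _ = ⊥-elim (d≢0 refl)
  ... | 1 | _   | _ = inj₁ refl
  ... | 2 | _   | _ = inj₂ refl
  ... | suc (suc (suc _)) | _ | s≤s (s≤s ())

  positive⇒≢ : ∀ {u v k} → d u v ≡ suc k → u ≢ v
  positive⇒≢ {u} e refl with trans (sym e) (zero-self u)
  ... | ()

  on-start : ∀ {u v} → On u v u
  on-start {u} {v} = inj₁ (cong (_+ d u v) (sym (zero-self u)))

  on-end : ∀ {u v} → On u v v
  on-end {u} {v} = inj₁ (sym (trans (cong (d u v +_) (zero-self v)) (+-identityʳ (d u v))))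

  on-short⇒ : ∀ {u v z} → d u v ≡ 1 → z ≢ u → z ≢ v → On u v z →
              (d u z ≡ 1 × d z v ≡ 2) ⊎ (d u z ≡ 2 × d z v ≡ 1)
  on-short⇒ e z≢u z≢v = degenerate-1 e (one-or-two (≢-sym z≢u)) (one-or-two z≢v)

  on-short⇐ : ∀ {u v z} → d u v ≡ 1 → (d u z ≡ 1 × d z v ≡ 2) ⊎ (d u z ≡ 2 × d z v ≡ 1) → On u v z
  on-short⇐ = degenerate-1⁻¹

  on-long⇒ : ∀ {u v z} → d u v ≡ 2 → z ≢ u → z ≢ v → On u v z → d u z ≡ 1 × d z v ≡ 1
  on-long⇒ e z≢u z≢v = degenerate-2 e (one-or-two (≢-sym z≢u)) (one-or-two z≢v)

  on-long⇐ : ∀ {u v z} → d u v ≡ 2 → d u z ≡ 1 → d z v ≡ 1 → On u v z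
  on-long⇐ = degenerate-2⁻¹

  module Around (x : Fin n) where

    Near Far : Fin n → Set
    Near v = d x v ≡ 1
    Far v = d x v ≡ 2

    near≢x : ∀ {v} → Near v → v ≢ x
    near≢x e = ≢-sym (positive⇒≢ e)

    far≢x : ∀ {v} → Far v → v ≢ x
    far≢x e = ≢-sym (positive⇒≢ e)

    near≢far : ∀ {u v} → Near u → Far v → u ≢ v
    near≢far nu fv refl = one≢two nu fv

    near-or-far : ∀ {v} → v ≢ x → Near v ⊎ Far v
    near-or-far v≢x = one-or-two (≢-sym v≢x)

    -- Two near points spanning the same line with x are twins: for u ∉ {x, v},
    -- d u v is determined by d x u and whether u lies on the line x v.
    near-twins : ∀ {v w} → Near v → Near w → v ≢ w → L x v ≡ L x w → Twins n d v w
    near-twins {v} {w} nv nw v≢w e = v≢w , d≢1 , same-distances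
      where
        d≢1 : d v w ≢ 1
        d≢1 h with on-short⇒ nv (near≢x nw) (≢-sym v≢w) (transport (sym e) on-end)
        ... | inj₁ (_ , dwv≡2) = one≢two (trans (d-sym w v) h) dwv≡2
        ... | inj₂ (dxw≡2 , _) = one≢two nw dxw≡2
        same-distances : ∀ u → u ≢ v → u ≢ w → d v u ≡ d w u
        same-distances u u≢v u≢w with u ≟ x
        ... | yes refl = trans (d-sym v x) (trans nv (sym (trans (d-sym w x) nw)))
        ... | no u≢x   = trans (d-sym v u) (trans duv≡duw (d-sym u w))
          where
            duv≡duw : d u v ≡ d u w
            duv≡duw = degenerate-1-determines nv nw (one-or-two (≢-sym u≢x)) (one-or-two u≢v) (one-or-two u≢w)
                        (transport e) (transport (sym e))

    far-lines-distinct : ∀ {v w} → Far v → Far w → v ≢ w → L x v ≢ L x w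
    far-lines-distinct fv fw v≢w e =
      one≢two (proj₁ (on-long⇒ fv (far≢x fw) (≢-sym v≢w) (transport (sym e) on-end))) fw

    far-line-twins : ∀ {w} → Far w → L x w ≡ ⊤ → Twins n d x w
    far-line-twins {w} fw univ = ≢-sym (far≢x fw) , (λ h → one≢two h fw) , same-distances
      where
        same-distances : ∀ u → u ≢ x → u ≢ w → d x u ≡ d w u
        same-distances u u≢x u≢w with on-long⇒ fw u≢x u≢w (universal⇒on u univ)
        ... | dxu≡1 , duw≡1 = trans dxu≡1 (sym (trans (d-sym w u) duw≡1))

    module Partner {y v : Fin n} (ny : Near y) (fv : Far v) (same : L x y ≡ L x v) where

      partner-adjacent : d y v ≡ 1
      partner-adjacent with on-short⇒ ny (far≢x fv) (≢-sym (near≢far ny fv)) (transport (sym same) on-end)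
      ... | inj₁ (dxv≡1 , _) = ⊥-elim (one≢two dxv≡1 fv)
      ... | inj₂ (_ , dvy≡1) = trans (d-sym y v) dvy≡1

      -- v is the only far point adjacent to y: another one would lie on L x y
      -- but not on L x v
      partner-far : ∀ {b} → Far b → b ≢ v → d y b ≡ 2
      partner-far {b} fb b≢v with one-or-two (near≢far ny fb)
      ... | inj₂ dyb≡2 = dyb≡2
      ... | inj₁ dyb≡1 = ⊥-elim (one≢two (proj₁ (on-long⇒ fv (far≢x fb) b≢v (transport same on-b))) fb)
        where
          on-b : On x y b
          on-b = on-short⇐ ny (inj₂ (fb , trans (d-sym b y) dyb≡1))

      partner-unique : ∀ {b} → Far b → d y b ≡ 1 → b ≡ v
      partner-unique {b} fb dyb≡1 with b ≟ v
      ... | yes b≡v = b≡v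
      ... | no b≢v  = ⊥-elim (one≢two dyb≡1 (partner-far fb b≢v))

      near-on-partner-line : ∀ {a} → Near a → a ≢ y → On y v a
      near-on-partner-line {a} na a≢y with one-or-two (≢-sym a≢y)
      ... | inj₁ dya≡1 = on-short⇐ partner-adjacent (inj₁ (dya≡1 , dav≡2))
        where
          dav≡2 : d a v ≡ 2
          dav≡2 with one-or-two (near≢far na fv)
          ... | inj₂ dav≡2 = dav≡2
          ... | inj₁ dav≡1 with on-short⇒ ny (near≢x na) a≢y (transport (sym same) (on-long⇐ fv na dav≡1))
          ...   | inj₁ (_ , day≡2) = ⊥-elim (one≢two (trans (d-sym a y) dya≡1) day≡2)
          ...   | inj₂ (dxa≡2 , _) = ⊥-elim (one≢two na dxa≡2)
      ... | inj₂ dya≡2 = on-short⇐ partner-adjacent (inj₂ (dya≡2 , dav≡1))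
        where
          dav≡1 : d a v ≡ 1
          dav≡1 = proj₂ (on-long⇒ fv (near≢x na) (near≢far na fv)
                           (transport same (on-short⇐ ny (inj₁ (na , trans (d-sym a y) dya≡2)))))

      off-partner-line : ∀ {z} → ¬ On y v z → Far z × z ≢ v × d z v ≡ 2
      off-partner-line {z} off with near-or-far z≢x
        where
          z≢x : z ≢ x
          z≢x refl = off (on-short⇐ partner-adjacent (inj₁ (trans (d-sym y x) ny , fv)))
      ... | inj₁ nz = ⊥-elim (off (near-on-partner-line nz (λ { refl → off on-start })))
      ... | inj₂ fz = fz , z≢v , dzv≡2
        where
          z≢v : z ≢ v
          z≢v refl = off on-end
          dzv≡2 : d z v ≡ 2
          dzv≡2 with one-or-two z≢v
          ... | inj₂ dzv≡2 = dzv≡2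
          ... | inj₁ dzv≡1 = ⊥-elim (off (on-short⇐ partner-adjacent (inj₂ (partner-far fz z≢v , dzv≡1))))

      distant-far-point : ¬ L y v ≡ ⊤ → Σ (Fin n) λ b → Far b × b ≢ v × d b v ≡ 2
      distant-far-point not-univ with ¬∀⟶∃¬ n (On y v) (onLine? n d y v) (λ all → not-univ (on⇒universal all))
      ... | z , off = z , off-partner-line off

    -- If x lies on every line, the space has twins: there is at most one far
    -- point, near points are pairwise at distance 2 and adjacent to every far
    -- point; so x is a twin of the far point, or any two near points are twins.
    module AllLinesThrough (through : ∀ p q → p ≢ q → On p q x) where

      far-far : ∀ {p q} → Far p → Far q → p ≢ q → ⊥
      far-far {p} {q} fp fq p≢q with one-or-two p≢q
      ... | inj₁ dpq≡1 with on-short⇒ dpq≡1 (≢-sym (far≢x fp)) (≢-sym (far≢x fq)) (through p q p≢q)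
      ...   | inj₁ (dpx≡1 , _) = one≢two (trans (d-sym x p) dpx≡1) fp
      ...   | inj₂ (_ , dxq≡1) = one≢two dxq≡1 fq
      far-far {p} {q} fp fq p≢q | inj₂ dpq≡2 =
        one≢two (trans (d-sym x p) (proj₁ (on-long⇒ dpq≡2 (≢-sym (far≢x fp)) (≢-sym (far≢x fq)) (through p q p≢q)))) fp

      near-near : ∀ {p q} → Near p → Near q → p ≢ q → d p q ≡ 2
      near-near {p} {q} np nq p≢q with one-or-two p≢q
      ... | inj₂ dpq≡2 = dpq≡2
      ... | inj₁ dpq≡1 with on-short⇒ dpq≡1 (≢-sym (near≢x np)) (≢-sym (near≢x nq)) (through p q p≢q)
      ...   | inj₁ (_ , dxq≡2) = ⊥-elim (one≢two nq dxq≡2)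
      ...   | inj₂ (dpx≡2 , _) = ⊥-elim (one≢two (trans (d-sym p x) np) dpx≡2)

      near-far : ∀ {p q} → Near p → Far q → d p q ≡ 1
      near-far {p} {q} np fq with one-or-two (near≢far np fq)
      ... | inj₁ dpq≡1 = dpq≡1
      ... | inj₂ dpq≡2 =
        ⊥-elim (one≢two (proj₂ (on-long⇒ dpq≡2 (≢-sym (near≢x np)) (≢-sym (far≢x fq)) (through p q (near≢far np fq)))) fq)

      twins : 3 ≤ n → Σ (Fin n) λ a → Σ (Fin n) λ a' → Twins n d a a'
      twins three with any? (λ b → d x b ≟ℕ 2)
      ... | yes (b , fb) = x , b , ≢-sym (far≢x fb) , (λ h → one≢two h fb) , same-distances
        where
          same-distances : ∀ u → u ≢ x → u ≢ b → d x u ≡ d b u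
          same-distances u u≢x u≢b with near-or-far u≢x
          ... | inj₁ nu = trans nu (sym (trans (d-sym b u) (near-far nu fb)))
          ... | inj₂ fu = ⊥-elim (far-far fu fb u≢b)
      ... | no no-far with two-others three x
      ...   | p , q , p≢x , q≢x , p≢q = p , q , p≢q , (λ h → one≢two h (near-near np nq p≢q)) , same-distances
        where
          near : ∀ {u} → u ≢ x → Near u
          near {u} u≢x with near-or-far u≢x
          ... | inj₁ nu = nu
          ... | inj₂ fu = ⊥-elim (no-far (u , fu))
          np : Near p
          np = near p≢x
          nq : Near q
          nq = near q≢x
          same-distances : ∀ u → u ≢ p → u ≢ q → d p u ≡ d q u
          same-distances u u≢p u≢q with u ≟ x
          ... | yes refl = trans (d-sym p x) (trans np (sym (trans (d-sym q x) nq)))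
          ... | no u≢x   = trans (near-near np (near u≢x) (≢-sym u≢p)) (sym (near-near nq (near u≢x) (≢-sym u≢q)))

  module Labelling (three : 3 ≤ n) (no-twins : NoTwins n d) (x : Fin n) where
    open Around x

    FarPairFree : Set
    FarPairFree = ∀ p q → Far p → Far q → d p q ≢ 2

    -- condition on the pair labelling x itself, needed to keep its line apart
    -- from the lines of crossing labels below
    BaseCondition : Fin n → Fin n → Set
    BaseCondition p q = FarPairFree ⊎ (d p q ≡ 2 × Far p × Far q)

    line-avoiding-x : Σ (Fin n) λ p → Σ (Fin n) λ q → p ≢ q × ¬ On p q x
    line-avoiding-x with any? (λ p → any? (λ q → ¬? (p ≟ q) ×-dec ¬? (onLine? n d p q x)))
    ... | yes (p , q , p≢q , off) = p , q , p≢q , off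
    ... | no none with AllLinesThrough.twins through three
      where
        through : ∀ p q → p ≢ q → On p q x
        through p q p≢q = decidable-stable (onLine? n d p q x) (λ off → none (p , q , p≢q , off))
    ...   | a , a' , twins = ⊥-elim (no-twins a a' twins)

    base-pair : Σ (Fin n) λ p → Σ (Fin n) λ q → p ≢ q × ¬ On p q x × BaseCondition p q
    base-pair with any? (λ p → any? (λ q → (d x p ≟ℕ 2) ×-dec ((d x q ≟ℕ 2) ×-dec (d p q ≟ℕ 2))))
    ... | yes (p , q , fp , fq , dpq≡2) = p , q , positive⇒≢ dpq≡2 , off , inj₂ (dpq≡2 , fp , fq)
      where
        off : ¬ On p q x
        off on = one≢two (trans (d-sym x p) (proj₁ (on-long⇒ dpq≡2 (≢-sym (far≢x fp)) (≢-sym (far≢x fq)) on))) fp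
    ... | no no-far-pair with line-avoiding-x
    ...   | p , q , p≢q , off = p , q , p≢q , off , inj₁ (λ p q fp fq dpq≡2 → no-far-pair (p , q , fp , fq , dpq≡2))

    data ThroughX (v : Fin n) : Set where
      near-label      : Near v → ThroughX v
      lonely-label    : Far v → (∀ y → Near y → L x y ≢ L x v) → ThroughX v
      universal-label : Far v → (y : Fin n) → Near y → L x y ≡ L x v → L y v ≡ ⊤ → ThroughX v

    data AvoidsX (v : Fin n) : Set where
      crossing-label : Far v → (y : Fin n) → Near y → L x y ≡ L x v →
                       (b : Fin n) → Far b → b ≢ v → d b v ≡ 2 → AvoidsX v
      base-label     : v ≡ x → (p q : Fin n) → p ≢ q → ¬ On p q x → BaseCondition p q → AvoidsX v

    Label : Fin n → Set
    Label v = ThroughX v ⊎ AvoidsX v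

    through-pair : ∀ {v} → ThroughX v → Fin n × Fin n
    through-pair {v} (near-label _)              = x , v
    through-pair {v} (lonely-label _ _)          = x , v
    through-pair {v} (universal-label _ y _ _ _) = y , v

    avoids-pair : ∀ {v} → AvoidsX v → Fin n × Fin n
    avoids-pair (crossing-label _ y _ _ b _ _ _) = y , b
    avoids-pair (base-label _ p q _ _ _)         = p , q

    pair : ∀ {v} → Label v → Fin n × Fin n
    pair (inj₁ c) = through-pair c
    pair (inj₂ c) = avoids-pair c

    label : (v : Fin n) → Label v
    label v with v ≟ x
    ... | yes v≡x with base-pair
    ...   | p , q , p≢q , off , base = inj₂ (base-label v≡x p q p≢q off base)
    label v | no v≢x with near-or-far v≢x
    ...   | inj₁ nv = inj₁ (near-label nv)
    ...   | inj₂ fv with any? (λ y → (d x y ≟ℕ 1) ×-dec subset-≟ (L x y) (L x v))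
    ...     | no no-partner = inj₁ (lonely-label fv (λ y ny same → no-partner (y , ny , same)))
    ...     | yes (y , ny , same) with subset-≟ (L y v) ⊤
    ...       | yes univ    = inj₁ (universal-label fv y ny same univ)
    ...       | no not-univ with Partner.distant-far-point ny fv same not-univ
    ...         | b , fb , b≢v , dbv≡2 = inj₂ (crossing-label fv y ny same b fb b≢v dbv≡2)

    pair-distinct : ∀ {v} (c : Label v) → proj₁ (pair c) ≢ proj₂ (pair c)
    pair-distinct (inj₁ (near-label nv))                       = ≢-sym (near≢x nv)
    pair-distinct (inj₁ (lonely-label fv _))                   = ≢-sym (far≢x fv)
    pair-distinct (inj₁ (universal-label fv _ ny _ _))         = near≢far ny fv
    pair-distinct (inj₂ (crossing-label _ _ ny _ _ fb _ _))    = near≢far ny fb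
    pair-distinct (inj₂ (base-label _ _ _ p≢q _ _))            = p≢q

    through-on : ∀ {v} (c : ThroughX v) → On (proj₁ (through-pair c)) (proj₂ (through-pair c)) x
    through-on (near-label _)                 = on-start
    through-on (lonely-label _ _)             = on-start
    through-on (universal-label _ _ _ _ univ) = universal⇒on x univ

    avoids-off : ∀ {v} (c : AvoidsX v) → ¬ On (proj₁ (avoids-pair c)) (proj₂ (avoids-pair c)) x
    avoids-off (crossing-label fv y ny same b fb b≢v _) on =
      one≢two (proj₂ (on-long⇒ (Partner.partner-far ny fv same fb b≢v) (≢-sym (near≢x ny)) (≢-sym (far≢x fb)) on)) fb
    avoids-off (base-label _ _ _ _ off _) = off

    separate-through : ∀ {v w} → v ≢ w → (c : ThroughX v) (c' : ThroughX w) →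
                       lineOf (through-pair c) ≡ lineOf (through-pair c') →
                       lineOf (through-pair c) ≡ ⊤ × ¬ SamePair (through-pair c) (through-pair c')
    separate-through v≢w (near-label nv) (near-label nw) e = ⊥-elim (no-twins _ _ (near-twins nv nw v≢w e))
    separate-through {v} v≢w (near-label nv) (lonely-label _ lonely) e = ⊥-elim (lonely v nv e)
    separate-through v≢w (near-label _) (universal-label fw y ny _ univ) e =
      trans e univ , λ { (inj₁ (x≡y , _)) → near≢x ny (sym x≡y) ; (inj₂ (x≡w , _)) → far≢x fw (sym x≡w) }
    separate-through {w = w} v≢w (lonely-label _ lonely) (near-label nw) e = ⊥-elim (lonely w nw (sym e))
    separate-through v≢w (lonely-label fv _) (lonely-label fw _) e = ⊥-elim (far-lines-distinct fv fw v≢w e)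
    separate-through v≢w (lonely-label fv _) (universal-label _ _ _ _ univ) e =
      ⊥-elim (no-twins _ _ (far-line-twins fv (trans e univ)))
    separate-through v≢w (universal-label fv y ny _ univ) (near-label _) e =
      univ , λ { (inj₁ (y≡x , _)) → near≢x ny y≡x ; (inj₂ (_ , v≡x)) → far≢x fv v≡x }
    separate-through v≢w (universal-label _ _ _ _ univ) (lonely-label fw _) e =
      ⊥-elim (no-twins _ _ (far-line-twins fw (trans (sym e) univ)))
    separate-through v≢w (universal-label _ y ny _ univ) (universal-label fw _ _ _ _) e =
      univ , λ { (inj₁ (_ , v≡w)) → v≢w v≡w ; (inj₂ (y≡w , _)) → near≢far ny fw y≡w }

    -- Crossing labels of distinct points have distinct lines: a partner y' of w
    -- on the line y b is the midpoint of y and b, forcing b = w; then w is the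
    -- midpoint of y' and b', contradicting d b' w = 2.
    crossing-crossing : ∀ {v w y y' b b'} → v ≢ w →
                        Far v → Near y → L x y ≡ L x v → Far b → b ≢ v →
                        Far w → Near y' → L x y' ≡ L x w → Far b' → b' ≢ w → d b' w ≡ 2 → L y b ≢ L y' b'
    crossing-crossing {v} {w} {y} {y'} {b} {b'} v≢w fv ny same fb b≢v fw ny' same' fb' b'≢w db'w≡2 e =
      one≢two (trans (d-sym b' w) dwb'≡1) db'w≡2
      where
        y≢y' : y ≢ y'
        y≢y' refl = far-lines-distinct fv fw v≢w (trans (sym same) same')
        dyb≡2 : d y b ≡ 2
        dyb≡2 = Partner.partner-far ny fv same fb b≢v
        b≡w : b ≡ w
        b≡w = Partner.partner-unique ny' fw same' fb
                (proj₂ (on-long⇒ dyb≡2 (≢-sym y≢y') (near≢far ny' fb) (transport (sym e) on-start)))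
        dwb'≡1 : d w b' ≡ 1
        dwb'≡1 = proj₂ (on-long⇒ (Partner.partner-far ny' fw same' fb' b'≢w) (≢-sym (near≢far ny' fw)) (≢-sym b'≢w)
                          (transport e (subst (On y b) b≡w on-end)))

    -- A crossing label and the base label have distinct lines: either the base
    -- condition forbids the far pair b, v, or y is the midpoint of the far pair
    -- p, q, making both equal to the unique far neighbour v of y.
    crossing-base : ∀ {v y b p q} → Far v → Near y → L x y ≡ L x v → Far b → d b v ≡ 2 →
                    p ≢ q → BaseCondition p q → L y b ≢ L p q
    crossing-base {v} {y} {b} {p} {q} fv ny same fb dbv≡2 p≢q (inj₁ far-pair-free) e = far-pair-free b v fb fv dbv≡2
    crossing-base {v} {y} {b} {p} {q} fv ny same fb dbv≡2 p≢q (inj₂ (dpq≡2 , fp , fq)) e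
      with on-long⇒ dpq≡2 (near≢far ny fp) (near≢far ny fq) (transport e on-start)
    ... | dpy≡1 , dyq≡1 = p≢q (trans (Partner.partner-unique ny fv same fp (trans (d-sym y p) dpy≡1))
                                     (sym (Partner.partner-unique ny fv same fq dyq≡1)))

    separate-avoids : ∀ {v w} → v ≢ w → (c : AvoidsX v) (c' : AvoidsX w) →
                      lineOf (avoids-pair c) ≢ lineOf (avoids-pair c')
    separate-avoids v≢w (crossing-label fv _ ny same _ fb b≢v _) (crossing-label fw _ ny' same' _ fb' b'≢w db'w≡2) =
      crossing-crossing v≢w fv ny same fb b≢v fw ny' same' fb' b'≢w db'w≡2
    separate-avoids v≢w (crossing-label fv _ ny same _ fb _ dbv≡2) (base-label _ _ _ p≢q _ base) =
      crossing-base fv ny same fb dbv≡2 p≢q base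
    separate-avoids v≢w (base-label _ _ _ p≢q _ base) (crossing-label fw _ ny same _ fb _ dbw≡2) e =
      crossing-base fw ny same fb dbw≡2 p≢q base (sym e)
    separate-avoids v≢w (base-label v≡x _ _ _ _ _) (base-label w≡x _ _ _ _ _) _ = v≢w (trans v≡x (sym w≡x))

    separate : ∀ {v w} → v ≢ w → (c : Label v) (c' : Label w) → lineOf (pair c) ≡ lineOf (pair c') →
               lineOf (pair c) ≡ ⊤ × ¬ SamePair (pair c) (pair c')
    separate v≢w (inj₁ c) (inj₁ c') e = separate-through v≢w c c' e
    separate v≢w (inj₁ c) (inj₂ c') e = ⊥-elim (avoids-off c' (transport e (through-on c)))
    separate v≢w (inj₂ c) (inj₁ c') e = ⊥-elim (avoids-off c (transport (sym e) (through-on c')))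
    separate v≢w (inj₂ c) (inj₂ c') e = ⊥-elim (separate-avoids v≢w c c' e)

proposition4 : (n : ℕ) (d : Fin n → Fin n → ℕ) → IsMetric n d → Dist012 n d →
                 3 ≤ n → NoTwins n d → n ≤ ℓ* n d + UP n d
proposition4 (suc n) d M D three no-twins =
  Counting.count d (IsMetric.sym M) (λ v → pair (label v)) (λ v → pair-distinct (label v))
    (λ v w v≢w → separate v≢w (label v) (label w))
  where open TwoDistance d M D
        open Labelling three no-twins F.zero
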